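{- Let $p$ be a prime, $k\in\mathbb{N}$ with $p^k\ge 3$, let $l,s\in\mathbb{N}$, and let $2\le m\le p^k-1$. Then for every nonnegative integer $b$, $$P\Big(\sum_{i=1}^m x_i^{\varphi(p^k)l}=b\,(p^s)^{\varphi(p^k)l}\Big)=P\Big(\sum_{i=1}^m x_i^{\varphi(p^k)l}=b\Big).$$
   Context: $P(f(x_1,\dots,x_m)=d)$ denotes the number of solutions $(x_1,\dots,x_m)$ in nonnegative integers. $\varphi$ is Euler's totient function. -}

module Defs where

open import Data.Nat using (ℕ; suc; _+_; _^_)
open import Data.Nat.GCD using (gcd)
open import Data.List using (List; filter; length)
open import Data.List.Base using (upTo)
open import Data.Vec using (Vec)
import Data.Vec as Vec
open import Data.Product using (Σ)
open import Relation.Binary.PropositionalEquality using (_≡_)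
open import Data.Nat using (_≟_)

φ : ℕ → ℕ
φ n = length (filter (λ i → gcd (suc i) n ≟ 1) (upTo n))

powSum : {m : ℕ} → ℕ → Vec ℕ m → ℕ
powSum e xs = Vec.sum (Vec.map (λ x → x ^ e) xs)

Sol : (m e d : ℕ) → Set
Sol m e d = Σ (Vec ℕ m) (λ xs → powSum e xs ≡ d)

-- For p ∤ x Euler's theorem gives x^φ(p^k) ≡ 1 (mod p^k), while for p ∣ x we have
-- p^k ∣ x^e as soon as e ≥ k, which holds since φ(p^k) ≥ k. Hence, modulo p^k, the power
-- sum x₁^e + ⋯ + x_m^e (e = φ(p^k) l, l ≥ 1) counts the xᵢ prime to p. If it equals
-- c·p^e this count is ≡ 0 (mod p^k) and at most m < p^k, so every xᵢ is a multiple of p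
-- and x ↦ x/p is a bijection onto the solutions for c. Iterating s times removes (p^s)^e.
-- The case l = 0 is trivial, and m ≥ 2 is never used.

module Submission where

open import Defs
open import Data.Nat using (ℕ; _*_; _^_; _≤_; _∸_)
open import Data.Nat.Primality using (Prime)
open import Function.Bundles using (_↔_)

open import Data.List using (List; []; _∷_; [_]; _++_; map; filter; length; upTo)
open import Data.List.Properties using (length-map; map-∘; map-id-local; upTo-∷ʳ; filter-++; filter-accept; length-++)
open import Data.List.Membership.Propositional using (_∈_)
open import Data.List.Membership.Propositional.Properties using (∈-map⁺; ∈-map⁻; ∈-filter⁺; ∈-filter⁻; ∈-upTo⁺; ∈-upTo⁻)
open import Data.List.Membership.Propositional.Properties.WithK using (unique∧set⇒bag)
open import Data.List.Relation.Binary.BagAndSetEquality using (∼bag⇒↭)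
open import Data.List.Relation.Binary.Permutation.Propositional using (_↭_)
import Data.List.Relation.Unary.All as List
open import Data.List.Relation.Unary.Unique.Propositional using (Unique)
import Data.List.Relation.Unary.Unique.Propositional.Properties as Unique
open import Data.Nat
open import Data.Nat.Coprimality using (Coprime; coprime-Bézout; coprime-divisor; coprime⇒gcd≡1; gcd≡1⇒coprime)
open import Data.Nat.DivMod
open import Data.Nat.Divisibility
open import Data.Nat.GCD using (gcd; module Bézout)
open import Data.Nat.ListAction using (product)
open import Data.Nat.ListAction.Properties using (product-↭)
open import Data.Nat.Primality using (prime⇒irreducible; prime⇒nonZero; prime⇒nonTrivial)
open import Data.Nat.Properties
open import Data.Nat.Tactic.RingSolver using (solve-∀)
open import Data.Product using (∃-syntax; _×_; _,_; proj₁; proj₂)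
open import Data.Sum using (inj₁; inj₂)
open import Data.Vec using (Vec; []; _∷_; count)
import Data.Vec as Vec
open import Data.Vec.Properties using (count≤n)
open import Data.Vec.Relation.Unary.All using (All; []; _∷_)
open import Function.Base using (_∘_)
open import Function.Bundles using (mk⇔; mk↔ₛ′)
open import Function.Properties.Inverse using (↔-refl; ↔-trans)
open import Relation.Binary.PropositionalEquality hiding ([_])
open import Relation.Nullary using (contradiction; yes; no; ¬?)
open import Relation.Unary using (Pred; Decidable)

^-distribʳ-* : ∀ m n o → (m * n) ^ o ≡ m ^ o * n ^ o
^-distribʳ-* m n zero = refl
^-distribʳ-* m n (suc o) = begin
  m * n * (m * n) ^ o     ≡⟨ cong (m * n *_) (^-distribʳ-* m n o) ⟩
  m * n * (m ^ o * n ^ o) ≡⟨ interchange m n (m ^ o) (n ^ o) ⟩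
  m * m ^ o * (n * n ^ o) ∎
  where
    open ≡-Reasoning
    interchange : ∀ a b c d → a * b * (c * d) ≡ a * c * (b * d)
    interchange = solve-∀

n<m^n : ∀ m n → 1 < m → n < m ^ n
n<m^n m zero 1<m = m^n>0 m {{>-nonZero (<-trans z<s 1<m)}} zero
n<m^n m (suc n) 1<m = begin-strict
  suc n         ≡⟨ +-identityʳ (suc n) ⟨
  suc n + 0     <⟨ +-mono-≤-< (n<m^n m n 1<m) (m^n>0 m {{m≢0}} n) ⟩
  m ^ n + m ^ n ≡⟨ cong (m ^ n +_) (sym (+-identityʳ (m ^ n))) ⟩
  2 * m ^ n     ≤⟨ *-monoˡ-≤ (m ^ n) 1<m ⟩
  m * m ^ n     ∎
  where
    open ≤-Reasoning
    m≢0 = >-nonZero (<-trans z<s 1<m)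

coprime-*ʳ : ∀ {m n o} → Coprime m n → Coprime m o → Coprime m (n * o)
coprime-*ʳ {m} m⊥n m⊥o (d∣m , d∣n*o) = m⊥o (d∣m , coprime-divisor d⊥n d∣n*o)
  where
    d⊥n : Coprime _ _
    d⊥n (e∣d , e∣n) = m⊥n (∣-trans e∣d d∣m , e∣n)

coprime-^ʳ : ∀ {m n} → Coprime m n → ∀ k → Coprime m (n ^ k)
coprime-^ʳ _    zero    (_ , d∣1) = ∣1⇒≡1 d∣1
coprime-^ʳ m⊥n (suc k) = coprime-*ʳ m⊥n (coprime-^ʳ m⊥n k)

∤-prime⇒coprime : ∀ {p m} → Prime p → p ∤ m → Coprime m p
∤-prime⇒coprime p-prime p∤m (d∣m , d∣p) with prime⇒irreducible p-prime d∣p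
... | inj₁ d≡1 = d≡1
... | inj₂ refl = contradiction d∣m p∤m

1+m*n-coprime : ∀ m n → Coprime (suc (m * n)) n
1+m*n-coprime m n {d} (d∣1+m*n , d∣n) =
  ∣1⇒≡1 (∣m+n∣m⇒∣n (subst (d ∣_) (+-comm 1 (m * n)) d∣1+m*n) (∣n⇒∣m*n m d∣n))

[m*[n%d]]%d≡[m*n]%d : ∀ m n d .{{_ : NonZero d}} → (m * (n % d)) % d ≡ (m * n) % d
[m*[n%d]]%d≡[m*n]%d m n d = begin
  (m * (n % d)) % d           ≡⟨ %-distribˡ-* m (n % d) d ⟩
  ((m % d) * (n % d % d)) % d ≡⟨ cong (λ r → ((m % d) * r) % d) (m%n%n≡m%n n d) ⟩
  ((m % d) * (n % d)) % d     ≡⟨ %-distribˡ-* m n d ⟨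
  (m * n) % d                 ∎
  where open ≡-Reasoning

[[m%d]*n]%d≡[m*n]%d : ∀ m n d .{{_ : NonZero d}} → ((m % d) * n) % d ≡ (m * n) % d
[[m%d]*n]%d≡[m*n]%d m n d rewrite *-comm (m % d) n | *-comm m n = [m*[n%d]]%d≡[m*n]%d n m d

%-congˡ-* : ∀ {m n} o d .{{_ : NonZero d}} → m % d ≡ n % d → (m * o) % d ≡ (n * o) % d
%-congˡ-* {m} {n} o d m≡n = begin
  (m * o) % d       ≡⟨ [[m%d]*n]%d≡[m*n]%d m o d ⟨
  ((m % d) * o) % d ≡⟨ cong (λ r → (r * o) % d) m≡n ⟩
  ((n % d) * o) % d ≡⟨ [[m%d]*n]%d≡[m*n]%d n o d ⟩
  (n * o) % d       ∎
  where open ≡-Reasoning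

product-map-*-% : ∀ a d .{{_ : NonZero d}} (vs : List ℕ) →
  product (map (λ v → (a * v) % d) vs) % d ≡ (a ^ length vs * product vs) % d
product-map-*-% a d [] = refl
product-map-*-% a d (v ∷ vs) = begin
  ((a * v) % d * scaled) % d                       ≡⟨ [[m%d]*n]%d≡[m*n]%d (a * v) scaled d ⟩
  (a * v * scaled) % d                             ≡⟨ [m*[n%d]]%d≡[m*n]%d (a * v) scaled d ⟨
  (a * v * (scaled % d)) % d                       ≡⟨ cong (λ r → (a * v * r) % d) (product-map-*-% a d vs) ⟩
  (a * v * ((a ^ length vs * product vs) % d)) % d ≡⟨ [m*[n%d]]%d≡[m*n]%d (a * v) _ d ⟩
  (a * v * (a ^ length vs * product vs)) % d       ≡⟨ cong (_% d) (interchange a v (a ^ length vs) (product vs)) ⟩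
  (a * a ^ length vs * (v * product vs)) % d       ∎
  where
    open ≡-Reasoning
    scaled = product (map (λ v → (a * v) % d) vs)
    interchange : ∀ a b c d → a * b * (c * d) ≡ a * c * (b * d)
    interchange = solve-∀

module Units (n : ℕ) (1<n : 1 < n) where

  instance
    n≢0 : NonZero n
    n≢0 = >-nonZero (<-trans z<s 1<n)

  1%n≡1 : 1 % n ≡ 1
  1%n≡1 = m<n⇒m%n≡m 1<n

  Invertible : ℕ → Set
  Invertible x = ∃[ y ] (y * x) % n ≡ 1

  invertible-* : ∀ {x y} → Invertible x → Invertible y → Invertible (x * y)
  invertible-* {x} {y} (x⁻¹ , x⁻¹x≡1) (y⁻¹ , y⁻¹y≡1) = y⁻¹ * x⁻¹ , (begin
    (y⁻¹ * x⁻¹ * (x * y)) % n ≡⟨ cong (_% n) (regroup y⁻¹ x⁻¹ x y) ⟩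
    (x⁻¹ * x * (y⁻¹ * y)) % n ≡⟨ %-congˡ-* (y⁻¹ * y) n (trans x⁻¹x≡1 (sym 1%n≡1)) ⟩
    (1 * (y⁻¹ * y)) % n       ≡⟨ cong (_% n) (*-identityˡ (y⁻¹ * y)) ⟩
    (y⁻¹ * y) % n             ≡⟨ y⁻¹y≡1 ⟩
    1                         ∎)
    where
      open ≡-Reasoning
      regroup : ∀ a b c d → a * b * (c * d) ≡ b * c * (a * d)
      regroup = solve-∀

  invertible-% : ∀ {x} → Invertible x → Invertible (x % n)
  invertible-% {x} (x⁻¹ , x⁻¹x≡1) = x⁻¹ , trans ([m*[n%d]]%d≡[m*n]%d x⁻¹ x n) x⁻¹x≡1

  invertible-product : ∀ {vs} → List.All Invertible vs → Invertible (product vs)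
  invertible-product List.[]           = 1 , 1%n≡1
  invertible-product (v⁻¹ List.∷ vs⁻¹) = invertible-* v⁻¹ (invertible-product vs⁻¹)

  invertible⇒coprime : ∀ {x} → Invertible x → Coprime x n
  invertible⇒coprime {x} (x⁻¹ , x⁻¹x≡1) {d} (d∣x , d∣n) =
    ∣1⇒≡1 (∣m+n∣m⇒∣n (subst (d ∣_) x⁻¹x≡qn+1 (∣n⇒∣m*n x⁻¹ d∣x)) (∣n⇒∣m*n q d∣n))
    where
      q = x⁻¹ * x / n
      x⁻¹x≡qn+1 : x⁻¹ * x ≡ q * n + 1
      x⁻¹x≡qn+1 = trans (m≡m%n+[m/n]*n (x⁻¹ * x) n) (trans (cong (_+ q * n) x⁻¹x≡1) (+-comm 1 (q * n)))

  coprime⇒invertible : ∀ {x} → Coprime x n → Invertible x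
  coprime⇒invertible {x} x⊥n with coprime-Bézout x⊥n
  ... | Bézout.+- a b 1+bn≡ax = a , (begin
    (a * x) % n     ≡⟨ cong (_% n) 1+bn≡ax ⟨
    (1 + b * n) % n ≡⟨ [m+kn]%n≡m%n 1 b n ⟩
    1 % n           ≡⟨ 1%n≡1 ⟩
    1               ∎)
    where open ≡-Reasoning
  -- Here a x ≡ -1 (mod n), so the inverse is (n - 1) a.
  ... | Bézout.-+ a b 1+ax≡bn = pred n * a , (begin
    (pred n * a * x) % n                ≡⟨ [m+n]%n≡m%n (pred n * a * x) n ⟨
    (pred n * a * x + n) % n            ≡⟨ cong (λ m → (pred n * a * x + m) % n) (suc-pred n) ⟨
    (pred n * a * x + suc (pred n)) % n ≡⟨ cong (_% n) (rearrange (pred n) a x) ⟩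
    (1 + pred n * (1 + a * x)) % n      ≡⟨ cong (λ m → (1 + pred n * m) % n) 1+ax≡bn ⟩
    (1 + pred n * (b * n)) % n          ≡⟨ cong (λ m → (1 + m) % n) (*-assoc (pred n) b n) ⟨
    (1 + pred n * b * n) % n            ≡⟨ [m+kn]%n≡m%n 1 (pred n * b) n ⟩
    1 % n                               ≡⟨ 1%n≡1 ⟩
    1                                   ∎)
    where
      open ≡-Reasoning
      rearrange : ∀ u a x → u * a * x + suc u ≡ 1 + u * (1 + a * x)
      rearrange = solve-∀

  invertible-cancelʳ : ∀ {c} → Invertible c → ∀ x y → (x * c) % n ≡ (y * c) % n → x % n ≡ y % n
  invertible-cancelʳ {c} (c⁻¹ , c⁻¹c≡1) x y xc≡yc = begin
    x % n             ≡⟨ cancel x ⟨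
    (x * c * c⁻¹) % n ≡⟨ %-congˡ-* c⁻¹ n xc≡yc ⟩
    (y * c * c⁻¹) % n ≡⟨ cancel y ⟩
    y % n             ∎
    where
      open ≡-Reasoning
      cancel : ∀ z → (z * c * c⁻¹) % n ≡ z % n
      cancel z = begin
        (z * c * c⁻¹) % n         ≡⟨ cong (_% n) (trans (*-assoc z c c⁻¹) (cong (z *_) (*-comm c c⁻¹))) ⟩
        (z * (c⁻¹ * c)) % n       ≡⟨ [m*[n%d]]%d≡[m*n]%d z (c⁻¹ * c) n ⟨
        (z * ((c⁻¹ * c) % n)) % n ≡⟨ cong (λ m → (z * m) % n) c⁻¹c≡1 ⟩
        (z * 1) % n               ≡⟨ cong (_% n) (*-identityʳ z) ⟩
        z % n                     ∎

  *-%-inverseˡ : ∀ c c⁻¹ {v} → (c⁻¹ * c) % n ≡ 1 → v < n → (c⁻¹ * ((c * v) % n)) % n ≡ v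
  *-%-inverseˡ c c⁻¹ {v} c⁻¹c≡1 v<n = begin
    (c⁻¹ * ((c * v) % n)) % n ≡⟨ [m*[n%d]]%d≡[m*n]%d c⁻¹ (c * v) n ⟩
    (c⁻¹ * (c * v)) % n       ≡⟨ cong (_% n) (*-assoc c⁻¹ c v) ⟨
    (c⁻¹ * c * v) % n         ≡⟨ %-congˡ-* v n (trans c⁻¹c≡1 (sym 1%n≡1)) ⟩
    (1 * v) % n               ≡⟨ cong (_% n) (*-identityˡ v) ⟩
    v % n                     ≡⟨ m<n⇒m%n≡m v<n ⟩
    v                         ∎
    where open ≡-Reasoning

  ^-%-≡1 : ∀ {y} → y % n ≡ 1 → ∀ l → (y ^ l) % n ≡ 1
  ^-%-≡1 y%n≡1 zero = 1%n≡1
  ^-%-≡1 {y} y%n≡1 (suc l) = begin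
    (y * y ^ l) % n             ≡⟨ %-distribˡ-* y (y ^ l) n ⟩
    ((y % n) * (y ^ l % n)) % n ≡⟨ cong₂ (λ a b → (a * b) % n) y%n≡1 (^-%-≡1 y%n≡1 l) ⟩
    1 % n                       ≡⟨ 1%n≡1 ⟩
    1                           ∎
    where open ≡-Reasoning

  reducedResidues : List ℕ
  reducedResidues = map suc (filter (λ i → gcd (suc i) n ≟ 1) (upTo n))

  length-reducedResidues : length reducedResidues ≡ φ n
  length-reducedResidues = length-map suc (filter (λ i → gcd (suc i) n ≟ 1) (upTo n))

  reducedResidues-unique : Unique reducedResidues
  reducedResidues-unique = Unique.map⁺ suc-injective (Unique.filter⁺ _ (Unique.upTo⁺ n))

  ∈-reducedResidues⁻ : ∀ {x} → x ∈ reducedResidues → x < n × Invertible x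
  ∈-reducedResidues⁻ x∈ with ∈-map⁻ suc x∈
  ... | i , i∈ , refl with ∈-filter⁻ (λ i → gcd (suc i) n ≟ 1) i∈
  ... | i∈upTo , gcd≡1 = ≤∧≢⇒< (∈-upTo⁻ i∈upTo) 1+i≢n , coprime⇒invertible 1+i⊥n
    where
      1+i⊥n : Coprime (suc i) n
      1+i⊥n = gcd≡1⇒coprime gcd≡1
      1+i≢n : suc i ≢ n
      1+i≢n 1+i≡n = >⇒≢ 1<n (subst (λ j → Coprime j n) 1+i≡n 1+i⊥n (∣-refl , ∣-refl))

  ∈-reducedResidues⁺ : ∀ {x} → x < n → Invertible x → x ∈ reducedResidues
  ∈-reducedResidues⁺ {zero} _ 0⁻¹ = contradiction (invertible⇒coprime 0⁻¹ (n ∣0 , ∣-refl)) (>⇒≢ 1<n)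
  ∈-reducedResidues⁺ {suc i} 1+i<n 1+i⁻¹ =
    ∈-map⁺ suc (∈-filter⁺ (λ i → gcd (suc i) n ≟ 1) (∈-upTo⁺ (<-trans (n<1+n i) 1+i<n))
                                                   (coprime⇒gcd≡1 (invertible⇒coprime 1+i⁻¹)))

  *-%-permutes : ∀ {a} → Invertible a → map (λ v → (a * v) % n) reducedResidues ↭ reducedResidues
  *-%-permutes {a} (a⁻¹ , a⁻¹a≡1) =
    ∼bag⇒↭ (unique∧set⇒bag scaled-unique reducedResidues-unique (mk⇔ scaled⊆ ⊆scaled))
    where
      scale unscale : ℕ → ℕ
      scale v = (a * v) % n
      unscale v = (a⁻¹ * v) % n

      aa⁻¹≡1 : (a * a⁻¹) % n ≡ 1
      aa⁻¹≡1 = trans (cong (_% n) (*-comm a a⁻¹)) a⁻¹a≡1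

      scale-∈ : ∀ {c} → Invertible c → ∀ {v} → v ∈ reducedResidues → (c * v) % n ∈ reducedResidues
      scale-∈ c⁻¹ v∈ =
        ∈-reducedResidues⁺ (m%n<n _ n) (invertible-% (invertible-* c⁻¹ (proj₂ (∈-reducedResidues⁻ v∈))))

      scaled⊆ : ∀ {z} → z ∈ map scale reducedResidues → z ∈ reducedResidues
      scaled⊆ z∈ with ∈-map⁻ scale z∈
      ... | v , v∈ , refl = scale-∈ (a⁻¹ , a⁻¹a≡1) v∈

      ⊆scaled : ∀ {z} → z ∈ reducedResidues → z ∈ map scale reducedResidues
      ⊆scaled z∈ = subst (_∈ map scale reducedResidues)
                         (*-%-inverseˡ a⁻¹ a aa⁻¹≡1 (proj₁ (∈-reducedResidues⁻ z∈)))
                         (∈-map⁺ scale (scale-∈ (a , aa⁻¹≡1) z∈))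

      unscale∘scale≡id : map unscale (map scale reducedResidues) ≡ reducedResidues
      unscale∘scale≡id = trans (sym (map-∘ reducedResidues))
        (map-id-local (List.tabulate (λ v∈ → *-%-inverseˡ a a⁻¹ a⁻¹a≡1 (proj₁ (∈-reducedResidues⁻ v∈)))))

      scaled-unique : Unique (map scale reducedResidues)
      scaled-unique = Unique.map⁻ (subst Unique (sym unscale∘scale≡id) reducedResidues-unique)

  -- Multiplying by a permutes the reduced residues, so a^φ(n) · ∏ ≡ ∏ and the product cancels.
  euler : ∀ {a} → Coprime a n → (a ^ φ n) % n ≡ 1
  euler {a} a⊥n = trans (invertible-cancelʳ ∏-invertible (a ^ φ n) 1 a^φ*∏≡1*∏) 1%n≡1
    where
      ∏ = product reducedResidues

      ∏-invertible : Invertible ∏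
      ∏-invertible = invertible-product (List.tabulate (λ v∈ → proj₂ (∈-reducedResidues⁻ v∈)))

      a^φ*∏≡1*∏ : (a ^ φ n * ∏) % n ≡ (1 * ∏) % n
      a^φ*∏≡1*∏ = begin
        (a ^ φ n * ∏) % n                    ≡⟨ cong (λ k → (a ^ k * ∏) % n) length-reducedResidues ⟨
        (a ^ length reducedResidues * ∏) % n ≡⟨ product-map-*-% a n reducedResidues ⟨
        product scaled % n                   ≡⟨ cong (_% n) (product-↭ (*-%-permutes (coprime⇒invertible a⊥n))) ⟩
        ∏ % n                                ≡⟨ cong (_% n) (*-identityˡ ∏) ⟨
        (1 * ∏) % n                          ∎
        where
          open ≡-Reasoning
          scaled = map (λ v → (a * v) % n) reducedResidues

module CountBelow {ℓ} {P : Pred ℕ ℓ} (P? : Decidable P) where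

  countBelow : ℕ → ℕ
  countBelow N = length (filter P? (upTo N))

  countBelow-suc : ∀ N → countBelow (suc N) ≡ countBelow N + length (filter P? [ N ])
  countBelow-suc N = begin
    length (filter P? (upTo (suc N)))             ≡⟨ cong (λ xs → length (filter P? xs)) (upTo-∷ʳ N) ⟨
    length (filter P? (upTo N ++ [ N ]))           ≡⟨ cong length (filter-++ P? (upTo N) [ N ]) ⟩
    length (filter P? (upTo N) ++ filter P? [ N ]) ≡⟨ length-++ (filter P? (upTo N)) ⟩
    countBelow N + length (filter P? [ N ])        ∎
    where open ≡-Reasoning

  countBelow-accept : ∀ {N} → P N → countBelow (suc N) ≡ suc (countBelow N)
  countBelow-accept {N} PN = begin
    countBelow (suc N)                      ≡⟨ countBelow-suc N ⟩
    countBelow N + length (filter P? [ N ]) ≡⟨ cong (λ xs → countBelow N + length xs) (filter-accept P? PN) ⟩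
    countBelow N + 1                        ≡⟨ +-comm (countBelow N) 1 ⟩
    suc (countBelow N)                      ∎
    where open ≡-Reasoning

  countBelow-mono : ∀ {N N′} → N ≤ N′ → countBelow N ≤ countBelow N′
  countBelow-mono = mono′ ∘ ≤⇒≤′
    where
      mono′ : ∀ {N N′} → N ≤′ N′ → countBelow N ≤ countBelow N′
      mono′ ≤′-refl = ≤-refl
      mono′ {N} (≤′-step {N′} N≤′N′) =
        ≤-trans (mono′ N≤′N′) (subst (countBelow N′ ≤_) (sym (countBelow-suc N′)) (m≤m+n _ _))

  countBelow-increasing : ∀ (f : ℕ → ℕ) → (∀ t → f t < f (suc t)) → (∀ t → P (f t)) →
                          ∀ j → suc j ≤ countBelow (suc (f j))
  countBelow-increasing f f-inc Pf zero = subst (1 ≤_) (sym (countBelow-accept (Pf 0))) (s≤s z≤n)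
  countBelow-increasing f f-inc Pf (suc j) = begin
    suc (suc j)                  ≤⟨ s≤s (countBelow-increasing f f-inc Pf j) ⟩
    suc (countBelow (suc (f j))) ≤⟨ s≤s (countBelow-mono (f-inc j)) ⟩
    suc (countBelow (f (suc j))) ≡⟨ countBelow-accept (Pf (suc j)) ⟨
    countBelow (suc (f (suc j))) ∎
    where open ≤-Reasoning

-- The numbers 1 + t m for t ≤ k - 1 are coprime to m^k and lie below it.
k≤φ[m^k] : ∀ m k → 1 < m → k ≤ φ (m ^ k)
k≤φ[m^k] m zero    _   = z≤n
k≤φ[m^k] m (suc j) 1<m =
  ≤-trans (countBelow-increasing (_* m) step coprime j) (countBelow-mono jm<m^[1+j])
  where
    open CountBelow (λ i → gcd (suc i) (m ^ suc j) ≟ 1)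
    instance
      m≢0 : NonZero m
      m≢0 = >-nonZero (<-trans z<s 1<m)
    step : ∀ t → t * m < suc t * m
    step t = m<n+m (t * m) (<-trans z<s 1<m)
    coprime : ∀ t → gcd (suc (t * m)) (m ^ suc j) ≡ 1
    coprime t = coprime⇒gcd≡1 (coprime-^ʳ (1+m*n-coprime t m) (suc j))
    jm<m^[1+j] : j * m < m ^ suc j
    jm<m^[1+j] = subst (j * m <_) (*-comm (m ^ j) m) (*-monoˡ-< m (n<m^n m j 1<m))

^-monoˡ-∣ : ∀ {m n} e → m ∣ n → m ^ e ∣ n ^ e
^-monoˡ-∣ {m} e (divides q refl) = divides (q ^ e) (^-distribʳ-* q m e)

^-monoʳ-∣ : ∀ m {k e} → k ≤ e → m ^ k ∣ m ^ e
^-monoʳ-∣ m {k} {e} k≤e =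
  divides (m ^ (e ∸ k)) (trans (cong (m ^_) (sym (m∸n+n≡m k≤e))) (^-distribˡ-+-* m (e ∸ k) k))

Sol-cong : ∀ {m} e {d d′} → d ≡ d′ → Sol m e d ↔ Sol m e d′
Sol-cong e refl = ↔-refl

Sol-≡ : ∀ {m} e {d} {xs ys : Vec ℕ m} {xs-sol : powSum e xs ≡ d} {ys-sol : powSum e ys ≡ d} →
        xs ≡ ys → _≡_ {A = Sol m e d} (xs , xs-sol) (ys , ys-sol)
Sol-≡ e {xs = xs} refl = cong (xs ,_) (≡-irrelevant _ _)

powSum-map-* : ∀ c e {m} (ys : Vec ℕ m) → powSum e (Vec.map (c *_) ys) ≡ c ^ e * powSum e ys
powSum-map-* c e []       = sym (*-zeroʳ (c ^ e))
powSum-map-* c e (y ∷ ys) = begin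
  (c * y) ^ e + powSum e (Vec.map (c *_) ys) ≡⟨ cong₂ _+_ (^-distribʳ-* c y e) (powSum-map-* c e ys) ⟩
  c ^ e * y ^ e + c ^ e * powSum e ys        ≡⟨ *-distribˡ-+ (c ^ e) (y ^ e) (powSum e ys) ⟨
  c ^ e * (y ^ e + powSum e ys)              ∎
  where open ≡-Reasoning

map-/-map-* : ∀ p .{{_ : NonZero p}} {m} (ys : Vec ℕ m) → Vec.map (_/ p) (Vec.map (p *_) ys) ≡ ys
map-/-map-* p []       = refl
map-/-map-* p (y ∷ ys) = cong₂ _∷_ (trans (cong (_/ p) (*-comm p y)) (m*n/n≡m y p)) (map-/-map-* p ys)

map-*-map-/ : ∀ p .{{_ : NonZero p}} {m} {xs : Vec ℕ m} → All (p ∣_) xs →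
              Vec.map (p *_) (Vec.map (_/ p) xs) ≡ xs
map-*-map-/ p []           = refl
map-*-map-/ p (p∣x ∷ p∣xs) = cong₂ _∷_ (m*[n/m]≡n p∣x) (map-*-map-/ p p∣xs)

Sol-*p^e↔Sol-of-multiples : ∀ {m} e c p .{{_ : NonZero p}} →
  (∀ (xs : Vec ℕ m) → powSum e xs ≡ c * p ^ e → All (p ∣_) xs) →
  Sol m e (c * p ^ e) ↔ Sol m e c
Sol-*p^e↔Sol-of-multiples {m} e c p multiples =
  mk↔ₛ′ divide multiply (λ (ys , _) → Sol-≡ e (map-/-map-* p ys))
                        (λ (xs , xs-sol) → Sol-≡ e (map-*-map-/ p (multiples xs xs-sol)))
  where
    instance
      p^e≢0 : NonZero (p ^ e)
      p^e≢0 = m^n≢0 p e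

    multiply : Sol m e c → Sol m e (c * p ^ e)
    multiply (ys , ys-sol) = Vec.map (p *_) ys , (begin
      powSum e (Vec.map (p *_) ys) ≡⟨ powSum-map-* p e ys ⟩
      p ^ e * powSum e ys          ≡⟨ cong (p ^ e *_) ys-sol ⟩
      p ^ e * c                    ≡⟨ *-comm (p ^ e) c ⟩
      c * p ^ e                    ∎)
      where open ≡-Reasoning

    divide : Sol m e (c * p ^ e) → Sol m e c
    divide (xs , xs-sol) = ys , *-cancelʳ-≡ (powSum e ys) c (p ^ e) (begin
      powSum e ys * p ^ e                    ≡⟨ *-comm (powSum e ys) (p ^ e) ⟩
      p ^ e * powSum e ys                    ≡⟨ powSum-map-* p e ys ⟨
      powSum e (Vec.map (p *_) ys)           ≡⟨ cong (powSum e) (map-*-map-/ p (multiples xs xs-sol)) ⟩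
      powSum e xs                            ≡⟨ xs-sol ⟩
      c * p ^ e                              ∎)
      where
        open ≡-Reasoning
        ys = Vec.map (_/ p) xs

Sol-*[p^s]^e↔Sol : ∀ {m} e p → (∀ c → Sol m e (c * p ^ e) ↔ Sol m e c) →
                   ∀ b s → Sol m e (b * (p ^ s) ^ e) ↔ Sol m e b
Sol-*[p^s]^e↔Sol e p _ b zero = Sol-cong e (trans (cong (b *_) (^-zeroˡ e)) (*-identityʳ b))
Sol-*[p^s]^e↔Sol e p divide b (suc s) =
  ↔-trans (Sol-cong e split) (↔-trans (divide (b * (p ^ s) ^ e)) (Sol-*[p^s]^e↔Sol e p divide b s))
  where
    regroup : ∀ b x y → b * (x * y) ≡ b * y * x
    regroup = solve-∀
    split : b * (p * p ^ s) ^ e ≡ b * (p ^ s) ^ e * p ^ e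
    split = trans (cong (b *_) (^-distribʳ-* p (p ^ s) e)) (regroup b (p ^ e) ((p ^ s) ^ e))

nonMultiples : ∀ p {m} → Vec ℕ m → ℕ
nonMultiples p = count (λ x → ¬? (p ∣? x))

nonMultiples≡0⇒multiples : ∀ p {m} (xs : Vec ℕ m) → nonMultiples p xs ≡ 0 → All (p ∣_) xs
nonMultiples≡0⇒multiples p []       _ = []
nonMultiples≡0⇒multiples p (x ∷ xs) none with p ∣? x
... | yes p∣x = p∣x ∷ nonMultiples≡0⇒multiples p xs none
... | no  _   = contradiction none λ ()

module PowerSumsModulo (p e N : ℕ) {{_ : NonZero p}} {{_ : NonZero N}} (N∣p^e : N ∣ p ^ e)
                       (units : ∀ x → p ∤ x → (x ^ e) % N ≡ 1 % N) where

  powSum-% : ∀ {m} (xs : Vec ℕ m) → powSum e xs % N ≡ nonMultiples p xs % N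
  powSum-% [] = refl
  powSum-% (x ∷ xs) with p ∣? x
  ... | yes p∣x = begin
    (x ^ e + powSum e xs) % N ≡⟨ %-remove-+ˡ (powSum e xs) (∣-trans N∣p^e (^-monoˡ-∣ e p∣x)) ⟩
    powSum e xs % N           ≡⟨ powSum-% xs ⟩
    nonMultiples p xs % N     ∎
    where open ≡-Reasoning
  ... | no p∤x = begin
    (x ^ e + powSum e xs) % N             ≡⟨ %-distribˡ-+ (x ^ e) (powSum e xs) N ⟩
    ((x ^ e) % N + powSum e xs % N) % N   ≡⟨ cong₂ (λ a b → (a + b) % N) (units x p∤x) (powSum-% xs) ⟩
    (1 % N + nonMultiples p xs % N) % N   ≡⟨ %-distribˡ-+ 1 (nonMultiples p xs) N ⟨
    suc (nonMultiples p xs) % N           ∎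
    where open ≡-Reasoning

  ∣powSum⇒multiples : ∀ {m} → m < N → (xs : Vec ℕ m) → N ∣ powSum e xs → All (p ∣_) xs
  ∣powSum⇒multiples m<N xs N∣powSum = nonMultiples≡0⇒multiples p xs (begin
    nonMultiples p xs     ≡⟨ m<n⇒m%n≡m (≤-<-trans (count≤n _ xs) m<N) ⟨
    nonMultiples p xs % N ≡⟨ powSum-% xs ⟨
    powSum e xs % N       ≡⟨ n∣m⇒m%n≡0 (powSum e xs) N N∣powSum ⟩
    0                     ∎)
    where open ≡-Reasoning

  Sol-*p^e↔Sol : ∀ {m} → m < N → ∀ c → Sol m e (c * p ^ e) ↔ Sol m e c
  Sol-*p^e↔Sol m<N c = Sol-*p^e↔Sol-of-multiples e c p λ xs xs-sol →
    ∣powSum⇒multiples m<N xs (subst (N ∣_) (sym xs-sol) (∣n⇒∣m*n c N∣p^e))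

theorem1 : (p k l s m b : ℕ) → Prime p → 3 ≤ p ^ k → 2 ≤ m → m ≤ p ^ k ∸ 1 →
    Sol m (φ (p ^ k) * l) (b * (p ^ s) ^ (φ (p ^ k) * l)) ↔ Sol m (φ (p ^ k) * l) b
theorem1 p k zero s m b _ _ _ _ =
  Sol-cong (φ (p ^ k) * 0) (trans (cong (λ e → b * (p ^ s) ^ e) (*-zeroʳ (φ (p ^ k)))) (*-identityʳ b))
theorem1 p k l@(suc _) s m b p-prime 3≤p^k _ m≤p^k∸1 =
  Sol-*[p^s]^e↔Sol e p (PowerSumsModulo.Sol-*p^e↔Sol p e (p ^ k) (^-monoʳ-∣ p k≤e) units m<p^k) b s
  where
    open Units (p ^ k) (<⇒≤ 3≤p^k)
    instance
      p≢0 : NonZero p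
      p≢0 = prime⇒nonZero p-prime
    e = φ (p ^ k) * l
    k≤e : k ≤ e
    k≤e = ≤-trans (k≤φ[m^k] p k (nonTrivial⇒n>1 p {{prime⇒nonTrivial p-prime}})) (m≤m*n (φ (p ^ k)) l)
    units : ∀ x → p ∤ x → (x ^ e) % p ^ k ≡ 1 % p ^ k
    units x p∤x = begin
      (x ^ e) % p ^ k               ≡⟨ cong (_% p ^ k) (^-*-assoc x (φ (p ^ k)) l) ⟨
      ((x ^ φ (p ^ k)) ^ l) % p ^ k ≡⟨ ^-%-≡1 (euler (coprime-^ʳ (∤-prime⇒coprime p-prime p∤x) k)) l ⟩
      1                             ≡⟨ 1%n≡1 ⟨
      1 % p ^ k                     ∎
      where open ≡-Reasoning
    m<p^k : m < p ^ k
    m<p^k = m≤pred[n]⇒suc[m]≤n (subst (m ≤_) (sym (pred[m∸n]≡m∸[1+n] (p ^ k) 0)) m≤p^k∸1)
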